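{- Let $G=(V,E)$ be a finite connected non-bipartite undirected graph and let $\mathcal K$ be an $\mathscr S$-free component of $G$. Then either $\mathcal K=V$, or there are exactly two edges of $G$ joining a vertex of $\mathcal K$ to a vertex of $V\setminus\mathcal K$.
   Context: A walk is a sequence of vertices with consecutive vertices adjacent (vertices and edges may repeat); its length is its number of edges; it is closed if it starts and ends at the same vertex. An edge is stubborn if it belongs to every closed walk of odd length in $G$; $\mathscr S$ is the set of stubborn edges. An $\mathscr S$-free component is the vertex set of a connected component of $G\setminus\mathscr S$ (the graph with all stubborn edges deleted). -}

module Defs where

open import Data.Nat using (ℕ; zero; suc; _+_)
open import Data.Fin using (Fin)
open import Data.Bool using (Bool; true; false)
open import Data.Product using (Σ; ∃; ∃-syntax; _×_; _,_)
open import Data.Sum using (_⊎_)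
open import Data.Empty using (⊥)
open import Relation.Nullary using (¬_)
open import Relation.Binary.PropositionalEquality using (_≡_; _≢_)

record Graph (n : ℕ) : Set where
  field
    adj   : Fin n → Fin n → Bool
    sym   : ∀ u v → adj u v ≡ adj v u
    irrfl : ∀ u → adj u u ≡ false

open Graph public

Odd : ℕ → Set
Odd m = Σ ℕ λ k → m ≡ suc (k + k)

module _ {n : ℕ} (G : Graph n) where

  Adj : Fin n → Fin n → Set
  Adj u v = adj G u v ≡ true

  data Walk : Fin n → Fin n → Set where
    [_]  : (u : Fin n) → Walk u u
    _∷_  : ∀ {u v w} → Adj u v → Walk v w → Walk u w

  length : ∀ {u v} → Walk u v → ℕ
  length [ _ ]   = 0
  length (_ ∷ w) = suc (length w)

  data EdgeIn (a b : Fin n) : ∀ {u v} → Walk u v → Set where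
    here-fwd  : ∀ {w} (e : Adj a b) (p : Walk b w) → EdgeIn a b (e ∷ p)
    here-bwd  : ∀ {w} (e : Adj b a) (p : Walk a w) → EdgeIn a b (e ∷ p)
    there     : ∀ {u v w} (e : Adj u v) {p : Walk v w} →
                EdgeIn a b p → EdgeIn a b (e ∷ p)

  Connected : Set
  Connected = ∀ u v → Walk u v

  Bipartite : Set
  Bipartite = Σ (Fin n → Bool) λ c → ∀ u v → Adj u v → c u ≢ c v

  Stubborn : Fin n → Fin n → Set
  Stubborn a b = Adj a b × (∀ x (w : Walk x x) → Odd (length w) → EdgeIn a b w)

  AdjFree : Fin n → Fin n → Set
  AdjFree u v = Adj u v × ¬ Stubborn u v

  data FreeWalk : Fin n → Fin n → Set where
    [_]  : (u : Fin n) → FreeWalk u u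
    _∷_  : ∀ {u v w} → AdjFree u v → FreeWalk v w → FreeWalk u w

  IsSFreeComponent : (Fin n → Set) → Set
  IsSFreeComponent K = Σ (Fin n) λ v →
    ∀ u → (K u → FreeWalk v u) × (FreeWalk v u → K u)

  -- an edge joining a vertex of K to a vertex outside K, recorded as the ordered
  -- pair (a , b) with a ∈ K and b ∉ K (each such edge corresponds to exactly one pair)
  Crossing : (Fin n → Set) → Fin n → Fin n → Set
  Crossing K a b = K a × ¬ K b × Adj a b

  ExactlyTwoCrossing : (Fin n → Set) → Set
  ExactlyTwoCrossing K =
    Σ (Fin n × Fin n) λ p → Σ (Fin n × Fin n) λ q →
      (let (a₁ , b₁) = p ; (a₂ , b₂) = q in
        Crossing K a₁ b₁ × Crossing K a₂ b₂ × p ≢ q ×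
        (∀ a b → Crossing K a b → ((a , b) ≡ p) ⊎ ((a , b) ≡ q)))

-- Let ab be a stubborn edge of a connected non-bipartite graph G. Colouring each vertex by
-- the parity of a walk in G − ab from a (or from b, if a is out of reach) gives a colouring
-- c that is proper on every edge except ab, whose ends get the same colour: a proper
-- colouring of G − ab that disagreed on a and b would be one of G. Writing δf for the set of
-- edges whose ends f colours differently, δc = E ∖ {ab}; so ab is never the only edge of a
-- cut δf, since c ⊕ f would properly colour G.
--
-- Every edge leaving K is stubborn, for otherwise it lies in G ∖ 𝒮. If there were just one,
-- K itself would be such a cut. If there were three, e₁, e₂ and e₃, let A and B be
-- c(e₁) ⊕ c(e₂) and c(e₁) ⊕ c(e₃), shifted to vanish on K (both are constant along the
-- edges of G ∖ 𝒮). Then δA = {e₁, e₂}, δB = {e₁, e₃}, and A ∧ B cuts exactly e₁.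
--
-- Reachability in a finite graph is decided by saturating a subset of its vertices; this
-- makes stubbornness and membership in K decidable, so all case distinctions are
-- constructive.

module Submission where

open import Defs hiding (sym)
open import Algebra.Bundles using (CommutativeRing)
open import Data.Bool using (Bool; true; false; not; _∧_; _xor_)
open import Data.Bool.Properties
  using (xor-same; xor-assoc; xor-identityʳ; xor-inverseˡ; xor-annihilates-not;
         not-distribˡ-xor; not-distribʳ-xor; not-involutive; ¬-not; xor-∧-commutativeRing)
  renaming (_≟_ to _≟ᵇ_)
open import Data.Fin using (Fin)
open import Data.Fin.Properties using (any?; all?; ¬∀⟶∃¬) renaming (_≟_ to _≟ᶠ_)
open import Data.Fin.Subset using (Subset; _∈_; _∪_; ⁅_⁆; _⊃_)
open import Data.Fin.Subset.Properties using (_∈?_; x∈⁅x⁆; x∈⁅y⁆⇒x≡y; p⊆p∪q; x∈p∪q⁺; x∈p∪q⁻)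
open import Data.Fin.Subset.Induction using (⊃-wellFounded)
open import Data.Nat using (ℕ; zero; suc; _+_)
open import Data.Nat.Properties using (+-suc)
open import Data.Product using (Σ; ∃; _×_; _,_; proj₁; proj₂)
open import Data.Product.Properties using (≡-dec)
open import Data.Sum using (_⊎_; inj₁; inj₂; [_,_]′)
import Data.Sum as Sum
open import Data.Empty using (⊥; ⊥-elim)
open import Function using (_∘_; id)
open import Induction.WellFounded using (Acc; acc)
open import Level using (0ℓ)
open import Relation.Binary using (Rel; Decidable; DecidableEquality; Symmetric)
open import Relation.Binary.Construct.Closure.ReflexiveTransitive
  using (Star; ε; _◅_; _◅◅_; fold; revApp; reverse)
open import Relation.Binary.PropositionalEquality
  using (_≡_; _≢_; refl; sym; trans; cong; cong₂; ≢-sym; module ≡-Reasoning)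
open import Relation.Nullary
  using (¬_; Dec; yes; no; does; ¬?; _×-dec_; _⊎-dec_; _→-dec_; contradiction)
open import Relation.Nullary.Decidable using (map′; decidable-stable; dec-true; dec-false)

open import Algebra.Properties.CommutativeSemigroup
  (CommutativeRing.+-commutativeSemigroup xor-∧-commutativeRing) using (interchange)

xor-telescope : ∀ x y z → (x xor y) xor (y xor z) ≡ x xor z
xor-telescope x y z = begin
  (x xor y) xor (y xor z) ≡⟨ xor-assoc x y (y xor z) ⟩
  x xor (y xor (y xor z)) ≡⟨ cong (x xor_) (sym (xor-assoc y y z)) ⟩
  x xor ((y xor y) xor z) ≡⟨ cong (λ w → x xor (w xor z)) (xor-same y) ⟩
  x xor z                 ∎
  where open ≡-Reasoning

xor-≡ : ∀ {x y} → x ≡ y → x xor y ≡ false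
xor-≡ {x} refl = xor-same x

xor-false⇒≡ : ∀ {x y} → x xor y ≡ false → x ≡ y
xor-false⇒≡ {false} {false} _ = refl
xor-false⇒≡ {true}  {true}  _ = refl

xor-true⇒≢ : ∀ {x y} → x xor y ≡ true → x ≢ y
xor-true⇒≢ x⊕y≡true x≡y = contradiction (trans (sym (xor-≡ x≡y)) x⊕y≡true) λ ()

xor-∧-interchange : ∀ {x y x′ y′} →
                    (x ≡ false × y ≡ false) ⊎ (x′ ≡ false × y′ ≡ false) ⊎ (x ≡ x′ × y ≡ y′) →
                    (x ∧ y) xor (x′ ∧ y′) ≡ (x xor x′) ∧ (y xor y′)
xor-∧-interchange (inj₁ (refl , refl)) = refl
xor-∧-interchange {x} {y} (inj₂ (inj₁ (refl , refl)))
  rewrite xor-identityʳ (x ∧ y) | xor-identityʳ x | xor-identityʳ y = refl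
xor-∧-interchange {x} {y} (inj₂ (inj₂ (refl , refl)))
  rewrite xor-same (x ∧ y) | xor-same x = refl

xor-∧-exclusive : ∀ p q r → ¬ (p ≡ true × q ≡ true) → ¬ (p ≡ true × r ≡ true) →
                  ¬ (q ≡ true × r ≡ true) → (p xor q) ∧ (p xor r) ≡ p
xor-∧-exclusive true  true  _     pq _  _  = contradiction (refl , refl) pq
xor-∧-exclusive true  false true  _  pr _  = contradiction (refl , refl) pr
xor-∧-exclusive true  false false _  _  _  = refl
xor-∧-exclusive false true  true  _  _  qr = contradiction (refl , refl) qr
xor-∧-exclusive false true  false _  _  _  = refl
xor-∧-exclusive false false _     _  _  _  = refl

-- Reachability in a finite decidable relation

module Reachability {n : ℕ} {R : Rel (Fin n) 0ℓ} (R? : Decidable R) (s : Fin n) where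

  record ReachableSet : Set where
    field
      members : Subset n
      source  : s ∈ members
      sound   : ∀ {x} → x ∈ members → Star R s x
      closed  : ∀ {x y} → x ∈ members → R x y → y ∈ members

  saturate : (S : Subset n) → s ∈ S → (∀ {x} → x ∈ S → Star R s x) → Acc _⊃_ S →
             ReachableSet
  saturate S s∈S sound (acc larger)
    with any? (λ x → any? λ y → x ∈? S ×-dec (¬? (y ∈? S) ×-dec R? x y))
  ... | yes (x , y , x∈S , y∉S , xy) =
    saturate (S ∪ ⁅ y ⁆) (p⊆p∪q _ s∈S) sound′ (larger (p⊆p∪q _ , y , y∈S′ , y∉S))
    where
    y∈S′ : y ∈ S ∪ ⁅ y ⁆
    y∈S′ = x∈p∪q⁺ (inj₂ (x∈⁅x⁆ y))
    sound′ : ∀ {z} → z ∈ S ∪ ⁅ y ⁆ → Star R s z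
    sound′ z∈S′ with x∈p∪q⁻ S ⁅ y ⁆ z∈S′
    ... | inj₁ z∈S = sound z∈S
    ... | inj₂ z∈⁅y⁆ with x∈⁅y⁆⇒x≡y y z∈⁅y⁆
    ... | refl = sound x∈S ◅◅ xy ◅ ε
  ... | no ¬escape = record
    { members = S ; source = s∈S ; sound = sound
    ; closed  = λ x∈S xy → decidable-stable (_ ∈? S) λ y∉S → ¬escape (_ , _ , x∈S , y∉S , xy)
    }

  reachableSet : ReachableSet
  reachableSet = saturate ⁅ s ⁆ (x∈⁅x⁆ s) from-s (⊃-wellFounded _)
    where
    from-s : ∀ {x} → x ∈ ⁅ s ⁆ → Star R s x
    from-s x∈⁅s⁆ with x∈⁅y⁆⇒x≡y s x∈⁅s⁆
    ... | refl = ε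

  open ReachableSet reachableSet

  reached : ∀ {x y} → x ∈ members → Star R x y → y ∈ members
  reached x∈ ε        = x∈
  reached x∈ (xy ◅ w) = reached (closed x∈ xy) w

  reachable? : ∀ t → Dec (Star R s t)
  reachable? t = map′ sound (reached source) (t ∈? members)

-- Parity of walks

odd : ℕ → Bool
odd zero    = false
odd (suc m) = not (odd m)

odd-double : ∀ k → odd (k + k) ≡ false
odd-double zero    = refl
odd-double (suc k) rewrite +-suc k k | not-involutive (odd (k + k)) = odd-double k

Odd⇒odd : ∀ {m} → Odd m → odd m ≡ true
Odd⇒odd (k , refl) = cong not (odd-double k)

odd⇒Odd : ∀ {m} → odd m ≡ true → Odd m
odd⇒Odd {suc zero}    _ = 0 , refl
odd⇒Odd {suc (suc m)} h with odd⇒Odd {m} (trans (sym (not-involutive (odd m))) h)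
... | k , refl = suc k , cong (suc ∘ suc) (sym (+-suc k k))

module _ {A : Set} {R : Rel A 0ℓ} where

  parity : ∀ {x y} → Star R x y → Bool
  parity ε       = false
  parity (_ ◅ w) = not (parity w)

  parity-◅◅ : ∀ {x y z} (p : Star R x y) (q : Star R y z) →
              parity (p ◅◅ q) ≡ parity p xor parity q
  parity-◅◅ ε       q = refl
  parity-◅◅ (_ ◅ p) q = trans (cong not (parity-◅◅ p q)) (not-distribˡ-xor (parity p) (parity q))

  parity-reverse : (R-sym : Symmetric R) → ∀ {x y} (p : Star R x y) →
                   parity (reverse R-sym p) ≡ parity p
  parity-reverse R-sym p = trans (parity-revApp p ε) (xor-identityʳ (parity p))
    where
    parity-revApp : ∀ {x y z} (p : Star R y x) (q : Star R y z) →
                    parity (revApp R-sym p q) ≡ parity p xor parity q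
    parity-revApp ε       q = refl
    parity-revApp (_ ◅ p) q = trans (parity-revApp p _)
      (trans (sym (not-distribʳ-xor (parity p) (parity q))) (not-distribˡ-xor (parity p) (parity q)))

  parity-telescopes : (f : A → Bool) → (∀ {u v} → R u v → f u xor f v ≡ true) →
                      ∀ {x y} (w : Star R x y) → parity w ≡ f x xor f y
  parity-telescopes f flips {x} ε = sym (xor-same (f x))
  parity-telescopes f flips {x} {y} (_◅_ {j = u} xu w) = begin
    not (parity w)                  ≡⟨ cong not (parity-telescopes f flips w) ⟩
    not (f u xor f y)               ≡⟨ cong (_xor (f u xor f y)) (sym (flips xu)) ⟩
    (f x xor f u) xor (f u xor f y) ≡⟨ xor-telescope (f x) (f u) (f y) ⟩
    f x xor f y                     ∎
    where open ≡-Reasoning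

  parity-differs-across : (R-sym : Symmetric R) → (∀ {x} (w : Star R x x) → parity w ≡ false) →
                          ∀ {r u v} (p : Star R r u) (q : Star R r v) → R u v →
                          parity p xor parity q ≡ true
  parity-differs-across R-sym even {r} p q uv = begin
    parity p xor parity q             ≡⟨ sym (not-involutive _) ⟩
    not (not (parity p xor parity q)) ≡⟨ cong not (not-distribʳ-xor (parity p) (parity q)) ⟩
    not (parity p xor not (parity q)) ≡⟨ cong not (sym closed-parity) ⟩
    not (parity closed)               ≡⟨ cong not (even closed) ⟩
    true                              ∎
    where
    open ≡-Reasoning
    closed : Star R r r
    closed = p ◅◅ uv ◅ reverse R-sym q
    closed-parity : parity closed ≡ parity p xor not (parity q)
    closed-parity = trans (parity-◅◅ p _) (cong (λ b → parity p xor not b) (parity-reverse R-sym q))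

-- Edges of a graph, walks avoiding an edge, and coboundaries

module _ {n : ℕ} where

  Edge : Set
  Edge = Fin n × Fin n

  _≟ₑ_ : DecidableEquality Edge
  _≟ₑ_ = ≡-dec _≟ᶠ_ _≟ᶠ_

  SameEdge : Edge → Fin n → Fin n → Set
  SameEdge e u v = e ≡ (u , v) ⊎ e ≡ (v , u)

  sameEdge? : ∀ e u v → Dec (SameEdge e u v)
  sameEdge? e u v = e ≟ₑ (u , v) ⊎-dec e ≟ₑ (v , u)

  ⟦_⟧ : Edge → Fin n → Fin n → Bool
  ⟦ e ⟧ u v = does (sameEdge? e u v)

  ⟦⟧-sound : ∀ {e u v} → ⟦ e ⟧ u v ≡ true → SameEdge e u v
  ⟦⟧-sound {e} {u} {v} = sound (sameEdge? e u v)
    where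
    sound : ∀ {A : Set} (a? : Dec A) → does a? ≡ true → A
    sound (yes a) _ = a

  ⟦⟧-true : ∀ {e u v} → SameEdge e u v → ⟦ e ⟧ u v ≡ true
  ⟦⟧-true {e} {u} {v} = dec-true (sameEdge? e u v)

  ⟦⟧-false : ∀ {e u v} → ¬ SameEdge e u v → ⟦ e ⟧ u v ≡ false
  ⟦⟧-false {e} {u} {v} = dec-false (sameEdge? e u v)

module _ {n : ℕ} (G : Graph n) where

  adj? : Decidable (Adj G)
  adj? u v = adj G u v ≟ᵇ true

  adj-sym : Symmetric (Adj G)
  adj-sym {u} {v} uv = trans (Graph.sym G v u) uv

  AdjWithout : Edge → Rel (Fin n) 0ℓ
  AdjWithout e u v = Adj G u v × ¬ SameEdge e u v

  adjWithout? : ∀ e → Decidable (AdjWithout e)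
  adjWithout? e u v = adj? u v ×-dec ¬? (sameEdge? e u v)

  adjWithout-sym : ∀ e → Symmetric (AdjWithout e)
  adjWithout-sym e (uv , ¬same) = adj-sym uv , ¬same ∘ Sum.swap

  EdgeIn-swap : ∀ {a b x y} {w : Walk G x y} → EdgeIn G a b w → EdgeIn G b a w
  EdgeIn-swap (here-fwd uv w) = here-bwd uv w
  EdgeIn-swap (here-bwd uv w) = here-fwd uv w
  EdgeIn-swap (there uv i)    = there uv (EdgeIn-swap i)

  stubborn-sym : ∀ {a b} → Stubborn G a b → Stubborn G b a
  stubborn-sym (ab , onOdd) = adj-sym ab , λ x w odd-w → EdgeIn-swap (onOdd x w odd-w)

  stubborn-same : ∀ {a b u v} → Stubborn G a b → SameEdge (a , b) u v → Stubborn G u v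
  stubborn-same st (inj₁ refl) = st
  stubborn-same st (inj₂ refl) = stubborn-sym st

  forget : ∀ {e x y} → Star (AdjWithout e) x y → Walk G x y
  forget ε              = [ _ ]
  forget ((uv , _) ◅ w) = uv ∷ forget w

  forget-avoids : ∀ {a b x y} (w : Star (AdjWithout (a , b)) x y) → ¬ EdgeIn G a b (forget w)
  forget-avoids ((_ , ¬same) ◅ w) (here-fwd _ _) = ¬same (inj₁ refl)
  forget-avoids ((_ , ¬same) ◅ w) (here-bwd _ _) = ¬same (inj₂ refl)
  forget-avoids (_ ◅ w)           (there _ i)    = forget-avoids w i

  parity-forget : ∀ {e x y} (w : Star (AdjWithout e) x y) → parity w ≡ odd (length G (forget w))
  parity-forget ε       = refl
  parity-forget (_ ◅ w) = cong not (parity-forget w)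

  avoid? : ∀ {a b x y} (W : Walk G x y) →
           EdgeIn G a b W ⊎ Σ (Star (AdjWithout (a , b)) x y) λ w → parity w ≡ odd (length G W)
  avoid? [ _ ] = inj₂ (ε , refl)
  avoid? {a} {b} (_∷_ {u} {v} uv W) with sameEdge? (a , b) u v
  ... | yes (inj₁ refl) = inj₁ (here-fwd uv W)
  ... | yes (inj₂ refl) = inj₁ (here-bwd uv W)
  ... | no ¬same with avoid? W
  ...   | inj₁ i        = inj₁ (there uv i)
  ...   | inj₂ (w , pw) = inj₂ ((uv , ¬same) ◅ w , cong not pw)

  stubborn-closed-even : ∀ {a b} → Stubborn G a b →
                         ∀ {x} (w : Star (AdjWithout (a , b)) x x) → parity w ≡ false
  stubborn-closed-even (_ , onOdd) {x} w = decidable-stable (parity w ≟ᵇ false) λ w-odd →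
    forget-avoids w (onOdd x (forget w) (odd⇒Odd (trans (sym (parity-forget w)) (¬-not w-odd))))

  Coboundary : (Fin n → Bool) → (Fin n → Fin n → Bool) → Set
  Coboundary f p = ∀ u v → Adj G u v → f u xor f v ≡ p u v

  coboundary? : ∀ f p → Dec (Coboundary f p)
  coboundary? f p = all? λ u → all? λ v → adj? u v →-dec (f u xor f v ≟ᵇ p u v)

  coboundary-xor : ∀ {f g p q} → Coboundary f p → Coboundary g q →
                   Coboundary (λ x → f x xor g x) (λ u v → p u v xor q u v)
  coboundary-xor {f} {g} δf δg u v uv =
    trans (interchange (f u) (g u) (f v) (g v)) (cong₂ _xor_ (δf u v uv) (δg u v uv))

  coboundary⇒bipartite : ∀ {f p} → Coboundary f p → (∀ u v → p u v ≡ true) → Bipartite G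
  coboundary⇒bipartite {f} δf all-true = f , λ u v uv → xor-true⇒≢ (trans (δf u v uv) (all-true u v))

  coboundary⇒stubborn : ∀ {f a b} → Coboundary f (λ u v → not (⟦ a , b ⟧ u v)) → Adj G a b →
                        Stubborn G a b
  coboundary⇒stubborn {f} {a} {b} δf ab = ab , on-odd
    where
    flips : ∀ {u v} → AdjWithout (a , b) u v → f u xor f v ≡ true
    flips {u} {v} (uv , ¬same) = trans (δf u v uv) (cong not (⟦⟧-false ¬same))
    on-odd : ∀ x (W : Walk G x x) → Odd (length G W) → EdgeIn G a b W
    on-odd x W odd-W with avoid? W
    ... | inj₁ ab∈W     = ab∈W
    ... | inj₂ (w , pw) = ⊥-elim (xor-true⇒≢ {f x} closed-odd refl)
      where
      closed-odd : f x xor f x ≡ true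
      closed-odd = trans (sym (parity-telescopes f flips w)) (trans pw (Odd⇒odd odd-W))

-- The 2-colouring attached to a stubborn edge

module StubbornColouring {n : ℕ} (G : Graph n) (conn : Connected G) (a b : Fin n) where

  private
    G∖ab : Rel (Fin n) 0ℓ
    G∖ab = AdjWithout G (a , b)

    from-a? : ∀ u → Dec (Star G∖ab a u)
    from-a? = Reachability.reachable? (adjWithout? G (a , b)) a

  reachable-from-a-or-b : ∀ {x y} → Star G∖ab a x ⊎ Star G∖ab b x → Walk G x y →
                          Star G∖ab a y ⊎ Star G∖ab b y
  reachable-from-a-or-b r [ _ ] = r
  reachable-from-a-or-b {x} r (_∷_ {v = v} xv w) with sameEdge? (a , b) x v
  ... | yes (inj₁ refl) = reachable-from-a-or-b (inj₂ ε) w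
  ... | yes (inj₂ refl) = reachable-from-a-or-b (inj₁ ε) w
  ... | no ¬same        = reachable-from-a-or-b (Sum.map (_◅◅ step) (_◅◅ step) r) w
    where
    step : Star G∖ab x v
    step = (xv , ¬same) ◅ ε

  from-b : ∀ {u} → ¬ Star G∖ab a u → Star G∖ab b u
  from-b {u} ¬from-a =
    [ (λ w → contradiction w ¬from-a) , id ]′ (reachable-from-a-or-b (inj₁ ε) (conn a u))

  anchored-parity : ∀ {u} → Dec (Star G∖ab a u) → Bool
  anchored-parity (yes w)       = parity w
  anchored-parity (no ¬from-a) = parity (from-b ¬from-a)

  colour : Fin n → Bool
  colour u = anchored-parity (from-a? u)

  module _ (stubborn : Stubborn G a b) where

    colour-flips : ∀ {u v} → G∖ab u v → colour u xor colour v ≡ true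
    colour-flips {u} {v} = flips (from-a? u) (from-a? v)
      where
      separated : ∀ {r} (p : Star G∖ab r u) (q : Star G∖ab r v) → G∖ab u v →
                  parity p xor parity q ≡ true
      separated = parity-differs-across (adjWithout-sym G (a , b)) (stubborn-closed-even G stubborn)
      flips : (du : Dec (Star G∖ab a u)) (dv : Dec (Star G∖ab a v)) → G∖ab u v →
              anchored-parity du xor anchored-parity dv ≡ true
      flips (yes p)  (yes q)  uv = separated p q uv
      flips (yes p)  (no ¬q) uv = contradiction (p ◅◅ uv ◅ ε) ¬q
      flips (no ¬p) (yes q)  uv = contradiction (q ◅◅ adjWithout-sym G (a , b) uv ◅ ε) ¬p
      flips (no ¬p) (no ¬q) uv = separated (from-b ¬p) (from-b ¬q) uv

    module _ (¬bipartite : ¬ Bipartite G) where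

      colour-ab : colour a ≡ colour b
      colour-ab = decidable-stable (colour a ≟ᵇ colour b) λ ca≢cb →
        ¬bipartite (colour , proper ca≢cb)
        where
        proper : colour a ≢ colour b → ∀ u v → Adj G u v → colour u ≢ colour v
        proper ca≢cb u v uv with sameEdge? (a , b) u v
        ... | yes (inj₁ refl) = ca≢cb
        ... | yes (inj₂ refl) = ca≢cb ∘ sym
        ... | no ¬same        = xor-true⇒≢ (colour-flips (uv , ¬same))

      same-colour : ∀ {u v} → SameEdge (a , b) u v → colour u ≡ colour v
      same-colour (inj₁ refl) = colour-ab
      same-colour (inj₂ refl) = sym colour-ab

      stubborn⇒coboundary : Coboundary G colour (λ u v → not (⟦ a , b ⟧ u v))
      stubborn⇒coboundary u v uv with sameEdge? (a , b) u v
      ... | yes same = trans (xor-≡ (same-colour same)) (cong not (sym (⟦⟧-true same)))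
      ... | no ¬same = trans (colour-flips (uv , ¬same)) (cong not (sym (⟦⟧-false ¬same)))

stubborn? : ∀ {n} (G : Graph n) → Connected G → ¬ Bipartite G → Decidable (Stubborn G)
stubborn? G conn ¬bipartite a b =
  map′ (λ (ab , δcolour) → coboundary⇒stubborn G {f = colour} δcolour ab)
       (λ st → proj₁ st , stubborn⇒coboundary st ¬bipartite)
       (adj? G a b ×-dec coboundary? G colour _)
  where open StubbornColouring G conn a b

stubborn-not-bridge : ∀ {n} (G : Graph n) → Connected G → ¬ Bipartite G →
                      ∀ {a b f} → Stubborn G a b → ¬ Coboundary G f (⟦ a , b ⟧)
stubborn-not-bridge G conn ¬bipartite {a} {b} {f} st δf =
  ¬bipartite (coboundary⇒bipartite G {f = λ x → colour x xor f x} δ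
                                     (λ u v → xor-inverseˡ (⟦ a , b ⟧ u v)))
  where
  open StubbornColouring G conn a b
  δ : Coboundary G (λ x → colour x xor f x) (λ u v → not (⟦ a , b ⟧ u v) xor ⟦ a , b ⟧ u v)
  δ = coboundary-xor G {f = colour} {g = f} (stubborn⇒coboundary st ¬bipartite) δf

-- An 𝒮-free component and the edges leaving it

module Component {n : ℕ} (G : Graph n) (conn : Connected G) (¬bipartite : ¬ Bipartite G)
                 (K : Fin n → Set) (v₀ : Fin n)
                 (component : ∀ u → (K u → FreeWalk G v₀ u) × (FreeWalk G v₀ u → K u)) where

  adjFree? : Decidable (AdjFree G)
  adjFree? u v = adj? G u v ×-dec ¬? (stubborn? G conn ¬bipartite u v)

  free-walk⇒star : ∀ {x y} → FreeWalk G x y → Star (AdjFree G) x y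
  free-walk⇒star [ _ ]    = ε
  free-walk⇒star (uv ∷ w) = uv ◅ free-walk⇒star w

  star⇒free-walk : ∀ {x y} → Star (AdjFree G) x y → FreeWalk G x y
  star⇒free-walk ε        = [ _ ]
  star⇒free-walk (uv ◅ w) = uv ∷ star⇒free-walk w

  K⇒reachable : ∀ {u} → K u → Star (AdjFree G) v₀ u
  K⇒reachable {u} = free-walk⇒star ∘ proj₁ (component u)

  reachable⇒K : ∀ {u} → Star (AdjFree G) v₀ u → K u
  reachable⇒K {u} = proj₂ (component u) ∘ star⇒free-walk

  K? : ∀ u → Dec (K u)
  K? u = map′ reachable⇒K K⇒reachable (Reachability.reachable? adjFree? v₀ u)

  Crosses : Edge → Set
  Crosses e = Crossing G K (proj₁ e) (proj₂ e)

  crossing? : ∀ e → Dec (Crosses e)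
  crossing? (a , b) = K? a ×-dec ¬? (K? b) ×-dec adj? G a b

  crossing⇒stubborn : ∀ {a b} → Crosses (a , b) → Stubborn G a b
  crossing⇒stubborn {a} {b} (Ka , ¬Kb , ab) =
    decidable-stable (stubborn? G conn ¬bipartite a b) λ ¬st →
    ¬Kb (reachable⇒K (K⇒reachable Ka ◅◅ (ab , ¬st) ◅ ε))

  leaves-K : ∀ {x y} → Walk G x y → K x → ¬ K y → ∃ Crosses
  leaves-K [ _ ] Kx ¬Ky = contradiction Kx ¬Ky
  leaves-K (_∷_ {v = v} xv w) Kx ¬Ky with K? v
  ... | yes Kv = leaves-K w Kv ¬Ky
  ... | no ¬Kv = (_ , v) , Kx , ¬Kv , xv

  first-crossing : ¬ (∀ v → K v) → ∃ Crosses
  first-crossing ¬everywhere with ¬∀⟶∃¬ n K K? ¬everywhere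
  ... | w , ¬Kw = leaves-K (conn v₀ w) (reachable⇒K ε) ¬Kw

  crossing-edge-splits : ∀ {e u v} → Crosses e → SameEdge e u v → (K u × ¬ K v) ⊎ (¬ K u × K v)
  crossing-edge-splits (Ka , ¬Kb , _) (inj₁ refl) = inj₁ (Ka , ¬Kb)
  crossing-edge-splits (Ka , ¬Kb , _) (inj₂ refl) = inj₂ (¬Kb , Ka)

  crossing-not-inside : ∀ {e u v} → Crosses e → K u → K v → ⟦ e ⟧ u v ≡ false
  crossing-not-inside cr Ku Kv = ⟦⟧-false λ same →
    [ (λ (_ , ¬Kv) → ¬Kv Kv) , (λ (¬Ku , _) → ¬Ku Ku) ]′ (crossing-edge-splits cr same)

  crossing-not-outside : ∀ {e u v} → Crosses e → ¬ K u → ¬ K v → ⟦ e ⟧ u v ≡ false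
  crossing-not-outside cr ¬Ku ¬Kv = ⟦⟧-false λ same →
    [ (λ (Ku , _) → ¬Ku Ku) , (λ (_ , Kv) → ¬Kv Kv) ]′ (crossing-edge-splits cr same)

  crossings-same-edge : ∀ {e e′ u v} → Crosses e → Crosses e′ →
                        SameEdge e u v → SameEdge e′ u v → e ≡ e′
  crossings-same-edge _ _ (inj₁ refl) (inj₁ refl) = refl
  crossings-same-edge _ _ (inj₂ refl) (inj₂ refl) = refl
  crossings-same-edge (_ , ¬Kv , _) (Kv , _ , _) (inj₁ refl) (inj₂ refl) = contradiction Kv ¬Kv
  crossings-same-edge (_ , ¬Ku , _) (Ku , _ , _) (inj₂ refl) (inj₁ refl) = contradiction Ku ¬Ku

  crossing-not-free : ∀ {e u v} → Crosses e → AdjFree G u v → ⟦ e ⟧ u v ≡ false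
  crossing-not-free cr (_ , ¬st) =
    ⟦⟧-false λ same → ¬st (stubborn-same G (crossing⇒stubborn cr) same)

  coboundary-constant-on-K : ∀ {f p} → Coboundary G f p →
                             (∀ {u v} → AdjFree G u v → p u v ≡ false) →
                             ∀ {x} → K x → f v₀ ≡ f x
  coboundary-constant-on-K {f} δf free-flat Kx =
    fold (λ y z → f y ≡ f z) (λ uv → trans (constant-across uv)) refl (K⇒reachable Kx)
    where
    constant-across : ∀ {u v} → AdjFree G u v → f u ≡ f v
    constant-across {u} {v} uv = xor-false⇒≡ (trans (δf u v (proj₁ uv)) (free-flat uv))

  insideK : Fin n → Bool
  insideK u = does (K? u)

  lone-crossing-coboundary : ∀ {e} → Crosses e → (∀ {e′} → Crosses e′ → e′ ≡ e) →
                             Coboundary G insideK ⟦ e ⟧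
  lone-crossing-coboundary {e} cr only u v uv = sides (K? u) (K? v)
    where
    sides : (Ku? : Dec (K u)) (Kv? : Dec (K v)) → does Ku? xor does Kv? ≡ ⟦ e ⟧ u v
    sides (yes Ku) (yes Kv) = sym (crossing-not-inside cr Ku Kv)
    sides (yes Ku) (no ¬Kv) = sym (⟦⟧-true (inj₁ (sym (only {u , v} (Ku , ¬Kv , uv)))))
    sides (no ¬Ku) (yes Kv) = sym (⟦⟧-true (inj₂ (sym (only {v , u} (Kv , ¬Ku , adj-sym G uv)))))
    sides (no ¬Ku) (no ¬Kv) = sym (crossing-not-outside cr ¬Ku ¬Kv)

  second-crossing : ∀ {e} → Crosses e → ∃ λ e′ → Crosses e′ × e′ ≢ e
  second-crossing {e} cr with any? (λ u → any? λ v → crossing? (u , v) ×-dec ¬? ((u , v) ≟ₑ e))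
  ... | yes (u , v , cr′ , e′≢e) = (u , v) , cr′ , e′≢e
  ... | no none = ⊥-elim (stubborn-not-bridge G conn ¬bipartite {f = insideK} (crossing⇒stubborn cr)
                                              (lone-crossing-coboundary cr only))
    where
    only : ∀ {e′} → Crosses e′ → e′ ≡ e
    only {u , v} cr′ = decidable-stable ((u , v) ≟ₑ e) λ e′≢e → none (u , v , cr′ , e′≢e)

  colourOf : Edge → Fin n → Bool
  colourOf e = StubbornColouring.colour G conn (proj₁ e) (proj₂ e)

  crossing-coboundary : ∀ {e} → Crosses e → Coboundary G (colourOf e) (λ u v → not (⟦ e ⟧ u v))
  crossing-coboundary cr =
    StubbornColouring.stubborn⇒coboundary G conn _ _ (crossing⇒stubborn cr) ¬bipartite

  difference : Edge → Edge → Fin n → Bool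
  difference e e′ x = colourOf e x xor colourOf e′ x

  relative : Edge → Edge → Fin n → Bool
  relative e e′ x = difference e e′ x xor difference e e′ v₀

  relative-coboundary : ∀ {e e′} → Crosses e → Crosses e′ →
                        Coboundary G (relative e e′) (λ u v → ⟦ e ⟧ u v xor ⟦ e′ ⟧ u v)
  relative-coboundary {e} {e′} cr cr′ u v uv = begin
    (d u xor c) xor (d v xor c) ≡⟨ interchange (d u) c (d v) c ⟩
    (d u xor d v) xor (c xor c) ≡⟨ cong ((d u xor d v) xor_) (xor-same c) ⟩
    (d u xor d v) xor false     ≡⟨ xor-identityʳ (d u xor d v) ⟩
    d u xor d v                 ≡⟨ coboundary-xor G {f = colourOf e} {g = colourOf e′}
                                     (crossing-coboundary cr) (crossing-coboundary cr′) u v uv ⟩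
    not (⟦ e ⟧ u v) xor not (⟦ e′ ⟧ u v) ≡⟨ xor-annihilates-not (⟦ e ⟧ u v) (⟦ e′ ⟧ u v) ⟩
    ⟦ e ⟧ u v xor ⟦ e′ ⟧ u v    ∎
    where
    open ≡-Reasoning
    d : Fin n → Bool
    d = difference e e′
    c : Bool
    c = d v₀

  relative-vanishes-on-K : ∀ {e e′ x} → Crosses e → Crosses e′ → K x → relative e e′ x ≡ false
  relative-vanishes-on-K {e} {e′} cr cr′ Kx =
    trans (sym (coboundary-constant-on-K {f = relative e e′} (relative-coboundary cr cr′) flat Kx))
          (xor-same (difference e e′ v₀))
    where
    flat : ∀ {u v} → AdjFree G u v → ⟦ e ⟧ u v xor ⟦ e′ ⟧ u v ≡ false
    flat uv = cong₂ _xor_ (crossing-not-free cr uv) (crossing-not-free cr′ uv)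

  no-third-crossing : ∀ {e₁ e₂ e₃} → Crosses e₁ → Crosses e₂ → Crosses e₃ →
                      e₁ ≢ e₂ → e₁ ≢ e₃ → e₂ ≢ e₃ → ⊥
  no-third-crossing {e₁} {e₂} {e₃} cr₁ cr₂ cr₃ e₁≢e₂ e₁≢e₃ e₂≢e₃ =
    stubborn-not-bridge G conn ¬bipartite {f = ψ} (crossing⇒stubborn cr₁) δψ
    where
    A B ψ : Fin n → Bool
    A = relative e₁ e₂
    B = relative e₁ e₃
    ψ x = A x ∧ B x

    exclusive : ∀ {e e′ u v} → Crosses e → Crosses e′ → e ≢ e′ →
                ¬ (⟦ e ⟧ u v ≡ true × ⟦ e′ ⟧ u v ≡ true)
    exclusive cr cr′ e≢e′ (t , t′) = e≢e′ (crossings-same-edge cr cr′ (⟦⟧-sound t) (⟦⟧-sound t′))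

    δψ : Coboundary G ψ ⟦ e₁ ⟧
    δψ u v uv = begin
      ψ u xor ψ v                   ≡⟨ xor-∧-interchange (vanishing (K? u) (K? v)) ⟩
      (A u xor A v) ∧ (B u xor B v) ≡⟨ cong₂ _∧_ (δA u v uv) (δB u v uv) ⟩
      (⟦ e₁ ⟧ u v xor ⟦ e₂ ⟧ u v) ∧ (⟦ e₁ ⟧ u v xor ⟦ e₃ ⟧ u v)
        ≡⟨ xor-∧-exclusive _ _ _ (exclusive cr₁ cr₂ e₁≢e₂) (exclusive cr₁ cr₃ e₁≢e₃)
                                 (exclusive cr₂ cr₃ e₂≢e₃) ⟩
      ⟦ e₁ ⟧ u v                    ∎
      where
      open ≡-Reasoning
      δA : Coboundary G A (λ u v → ⟦ e₁ ⟧ u v xor ⟦ e₂ ⟧ u v)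
      δA = relative-coboundary cr₁ cr₂
      δB : Coboundary G B (λ u v → ⟦ e₁ ⟧ u v xor ⟦ e₃ ⟧ u v)
      δB = relative-coboundary cr₁ cr₃
      A-vanishes : ∀ {x} → K x → A x ≡ false
      A-vanishes = relative-vanishes-on-K cr₁ cr₂
      B-vanishes : ∀ {x} → K x → B x ≡ false
      B-vanishes = relative-vanishes-on-K cr₁ cr₃
      vanishing : Dec (K u) → Dec (K v) →
                  (A u ≡ false × B u ≡ false) ⊎ (A v ≡ false × B v ≡ false) ⊎ (A u ≡ A v × B u ≡ B v)
      vanishing (yes Ku) _ = inj₁ (A-vanishes Ku , B-vanishes Ku)
      vanishing _ (yes Kv) = inj₂ (inj₁ (A-vanishes Kv , B-vanishes Kv))
      vanishing (no ¬Ku) (no ¬Kv) = inj₂ (inj₂ ( xor-false⇒≡ (trans (δA u v uv) (outside cr₁ cr₂))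
                                               , xor-false⇒≡ (trans (δB u v uv) (outside cr₁ cr₃))))
        where
        outside : ∀ {e e′} → Crosses e → Crosses e′ → ⟦ e ⟧ u v xor ⟦ e′ ⟧ u v ≡ false
        outside cr cr′ =
          cong₂ _xor_ (crossing-not-outside cr ¬Ku ¬Kv) (crossing-not-outside cr′ ¬Ku ¬Kv)

  exactly-two-crossing : ∀ {e₁ e₂} → Crosses e₁ → Crosses e₂ → e₁ ≢ e₂ → ExactlyTwoCrossing G K
  exactly-two-crossing {e₁} {e₂} cr₁ cr₂ e₁≢e₂ =
    e₁ , e₂ , cr₁ , cr₂ , e₁≢e₂ , λ a b cr → one-of (a , b) cr
    where
    one-of : ∀ e → Crosses e → e ≡ e₁ ⊎ e ≡ e₂
    one-of e cr with e ≟ₑ e₁ | e ≟ₑ e₂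
    ... | yes e≡e₁ | _        = inj₁ e≡e₁
    ... | no _     | yes e≡e₂ = inj₂ e≡e₂
    ... | no e≢e₁  | no e≢e₂  =
      ⊥-elim (no-third-crossing cr₁ cr₂ cr e₁≢e₂ (≢-sym e≢e₁) (≢-sym e≢e₂))

proposition4 : ∀ (n : ℕ) (G : Graph n) → Connected G → ¬ Bipartite G →
    (K : Fin n → Set) → IsSFreeComponent G K →
    (∀ v → K v) ⊎ ExactlyTwoCrossing G K
proposition4 n G conn ¬bipartite K (v₀ , component) = decide (all? K?)
  where
  open Component G conn ¬bipartite K v₀ component
  decide : Dec (∀ v → K v) → (∀ v → K v) ⊎ ExactlyTwoCrossing G K
  decide (yes everywhere) = inj₁ everywhere
  decide (no ¬everywhere) =
    let (e₁ , cr₁)         = first-crossing ¬everywhere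
        (e₂ , cr₂ , e₂≢e₁) = second-crossing cr₁
    in inj₂ (exactly-two-crossing cr₁ cr₂ (≢-sym e₂≢e₁))
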